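{- Let $k$ be a positive integer. Every smooth word of height $k$ over $\Sigma=\{1,2\}$ belongs to exactly one MRSE chain of height $k$; that is, the sets of members of the MRSE chains of height $k$ form a partition of $P^k(\varepsilon)$, the set of all smooth words of height $k$. Moreover, the number of MRSE chains of height $k$ is $|H^k| = 2\cdot 3^{k-1}$.
   Context: Let $\Sigma=\{1,2\}$ and $\Sigma^*$ the free monoid of finite words over $\Sigma$, with empty word $\varepsilon$. A run of a word is a maximal factor of consecutive identical letters. A finite word $w\in\Sigma^*$ is differentiable if neither $111$ nor $222$ occurs in it; its derivative $D(w)$ is the word whose $j$-th symbol is the length of the $j$-th run of $w$, where the first run and/or the last run of $w$ is discarded if it has length one (so $D(w)\in\Sigma^*$). A word $w$ is a smooth word ($C^\infty$-word) if it is arbitrarily often differentiable, i.e. $D^j(w)$ is defined and differentiable for all $j\ge 0$. The height $ht(w)$ of a nonempty smooth word $w$ is the smallest integer $k$ with $D^k(w)=\varepsilon$; the height of $\varepsilon$ is $0$. $P^k(\varepsilon)$ denotes the set of all smooth words of height $k$. For $u,w\in\Sigma^*$, write $u\prec w$ ($w$ is a simple right extension of $u$) if $w=u\alpha$ for some $\alpha\in\Sigma$. An MRSE (maximal right smooth extension) chain of height $k$ is a sequence $u_1\prec u_2\prec\cdots\prec u_m$ with all $u_i\in P^k(\varepsilon)$ such that there is no $v\in P^k(\varepsilon)$ with $v\prec u_1$ or $u_m\prec v$. $H^k$ denotes the set of all MRSE chains of height $k$. -}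

module Defs where

open import Data.Bool using (Bool; true; false; if_then_else_)
open import Data.Nat using (ℕ; zero; suc; _<_)
open import Data.List using (List; []; _∷_; _++_; [_]; reverse)
open import Data.List.NonEmpty using (List⁺; head; last; toList)
open import Data.List.Relation.Unary.All using (All)
open import Data.List.Relation.Unary.Linked using (Linked)
open import Data.Maybe using (Maybe; just; nothing; _>>=_)
open import Data.Product using (Σ; ∃; _×_)
open import Relation.Binary.PropositionalEquality using (_≡_; _≢_)
open import Relation.Nullary using (¬_)

data Letter : Set where
  one two : Letter

Word : Set
Word = List Letter

_==_ : Letter → Letter → Bool
one == one = true
two == two = true
_   == _   = false

-- Lengths of the consecutive runs (maximal blocks of equal letters), left to right.
runsFrom : Letter → ℕ → Word → List ℕ
runsFrom a n []      = n ∷ []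
runsFrom a n (b ∷ w) = if a == b then runsFrom a (suc n) w else (n ∷ runsFrom b 1 w)

runs : Word → List ℕ
runs []      = []
runs (a ∷ w) = runsFrom a 1 w

-- run lengths 1,2 become letters 1,2; any run of length ≥ 3 means not differentiable
lengthsToWord : List ℕ → Maybe Word
lengthsToWord []                  = just []
lengthsToWord (1 ∷ ns)            = lengthsToWord ns >>= λ v → just (one ∷ v)
lengthsToWord (2 ∷ ns)            = lengthsToWord ns >>= λ v → just (two ∷ v)
lengthsToWord (_ ∷ ns)            = nothing

dropOne : Word → Word
dropOne (one ∷ w) = w
dropOne w         = w

-- discard the first run and/or the last run if it has length one
trim : Word → Word
trim w = reverse (dropOne (reverse (dropOne w)))

-- The derivative D, partial: nothing iff w is not differentiable (contains 111 or 222)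
D : Word → Maybe Word
D w = lengthsToWord (runs w) >>= λ v → just (trim v)

Dⁱ : ℕ → Word → Maybe Word
Dⁱ zero    w = just w
Dⁱ (suc j) w = Dⁱ j w >>= D

-- smooth (C^∞) word: D^j(w) defined for all j
-- (D^j(w) differentiable for all j  ⇔  D^(j+1)(w) defined for all j)
Smooth : Word → Set
Smooth w = ∀ j → ∃ λ v → Dⁱ j w ≡ just v

HasHeight : ℕ → Word → Set
HasHeight k w = Smooth w × Dⁱ k w ≡ just [] × (∀ j → j < k → Dⁱ j w ≢ just [])

P : ℕ → Word → Set
P k w = HasHeight k w

_≺_ : Word → Word → Set
u ≺ w = ∃ λ (α : Letter) → w ≡ u ++ [ α ]

IsMRSE : ℕ → List⁺ Word → Set
IsMRSE k c =
  All (P k) (toList c) ×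
  Linked _≺_ (toList c) ×
  (∀ v → P k v → ¬ (v ≺ head c)) ×
  (∀ v → P k v → ¬ (last c ≺ v))

module Submission where

-- A word whose runs have length 1 or 2 is `integrate a x` for its run-length
-- word x, and its derivative is trim x.  Using the recursive height `Ht`
-- (equivalent to P), induction on the height shows that a word of height k
-- has at most one right extension of height k (`noBranch`) and that words of
-- height k have bounded length.  For any decidable class of words with these
-- two properties, the maximal chains are the chains grown from the initial
-- words (those without predecessor in the class); they partition the class and
-- correspond to the initial words (module `MaximalChains`).  Finally the
-- initial words of height k+2 are exactly the lifts of those of height k+1,
-- the integrals of p v q for the left pads p allowed by the first letter of v
-- and the right pad q forced by its last letter (`initials-spec`); a weight
-- count on first letters gives 2·3^k of them (`initials-length`).

open import Defs
open import Data.Nat using (ℕ; zero; suc; _+_; _*_; _^_; _≤_; _<_; z≤n; s≤s)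
open import Data.Nat.Properties
  using (module ≤-Reasoning; ≤-refl; ≤-trans; ≤-reflexive; n≤1+n; m≤n+m; +-suc; +-identityʳ; +-comm;
         +-monoʳ-≤; *-monoʳ-≤; *-distribˡ-+; *-comm; *-zeroʳ; 1+n≰n)
open import Data.List using (List; []; _∷_; _++_; [_]; reverse; length; map; concatMap; replicate; initLast; _∷ʳ′_)
open import Data.Nat.ListAction using (sum)
open import Data.Nat.ListAction.Properties using (sum-++)
open import Data.List.Properties
  using (++-assoc; ++-identityʳ; ∷ʳ-injective; ++-cancelʳ; length-++; length-map; length-reverse;
         reverse-++; reverse-involutive; map-++)
open import Data.List.NonEmpty using (List⁺; _∷_; _∷⁺_; head; last; toList)
open import Data.List.Relation.Unary.All using (All; []; _∷_)
import Data.List.Relation.Unary.All as All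
import Data.List.Relation.Unary.All.Properties as All
import Data.List.Relation.Unary.AllPairs as AllPairs
import Data.List.Relation.Unary.AllPairs.Properties as AllPairs
open import Data.List.Relation.Binary.Disjoint.Propositional using (Disjoint)
open import Data.List.Relation.Unary.Any using (here; there)
open import Data.List.Relation.Unary.Linked using (Linked; []; [-]; _∷_)
open import Data.List.Membership.Propositional using (_∈_; lose; find)
open import Data.List.Relation.Unary.Unique.Propositional using (Unique)
import Data.List.Relation.Unary.Unique.Propositional.Properties as Unique
open import Data.List.Membership.Propositional.Properties using (∉[]; ∈-map⁺; ∈-map⁻; ∈-++⁺ˡ; ∈-++⁺ʳ; ∈-++⁻; ∈-concatMap⁺; ∈-concatMap⁻)
open import Data.List.Reverse using (Reverse; []; _∶_∶ʳ_; reverseView)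
open import Data.Maybe using (Maybe; just; nothing; _>>=_)
open import Data.Product using (∃; ∃₂; _×_; _,_; proj₁; proj₂)
open import Data.Sum using (_⊎_; inj₁; inj₂)
open import Data.Empty using (⊥; ⊥-elim)
open import Relation.Binary.PropositionalEquality using (_≡_; _≢_; refl; sym; trans; cong; cong₂; subst; subst₂; module ≡-Reasoning)
open import Relation.Nullary using (¬_; Dec; yes; no)
open import Relation.Nullary.Decidable using (map′)
open import Function.Bundles using (_⇔_; mk⇔; Equivalence)

other : Letter → Letter
other one = two
other two = one

len : Letter → ℕ
len one = 1
len two = 2

StartsWith : Letter → Word → Set
StartsWith a w = ∃ λ t → w ≡ a ∷ t

EndsWith : Letter → Word → Set
EndsWith a w = ∃ λ y → w ≡ y ++ [ a ]

snocView : (w : Word) → w ≡ [] ⊎ ∃₂ λ y c → w ≡ y ++ [ c ]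
snocView w with initLast w
... | []       = inj₁ refl
... | y ∷ʳ′ c  = inj₂ (y , c , refl)

∷≢[] : ∀ {b : Letter} {t : Word} → _≢_ {A = Word} (b ∷ t) []
∷≢[] ()

≢[]-++ʳ : ∀ (xs : Word) {ys} → ys ≢ [] → xs ++ ys ≢ []
≢[]-++ʳ []      ys≢[] = ys≢[]
≢[]-++ʳ (_ ∷ _) _     ()

≢[]-++ˡ : ∀ {xs : Word} ys → xs ≢ [] → xs ++ ys ≢ []
≢[]-++ˡ {[]}    ys xs≢[] = ⊥-elim (xs≢[] refl)
≢[]-++ˡ {_ ∷ _} ys _     ()

snoc≢[] : ∀ (y : Word) c → y ++ [ c ] ≢ []
snoc≢[] y c = ≢[]-++ʳ y λ ()

length-snoc : ∀ (w : Word) α → length (w ++ [ α ]) ≡ suc (length w)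
length-snoc w α = trans (length-++ w) (+-comm (length w) 1)

≺-unique : ∀ {u u′ w} → u ≺ w → u′ ≺ w → u ≡ u′
≺-unique {u} {u′} (_ , refl) (_ , e) = proj₁ (∷ʳ-injective u u′ e)

-- The last element of a nonempty list, computed by structural recursion
-- (the library's `last` goes through a snoc view).
lastOf : ∀ {A : Set} → A → List A → A
lastOf x []       = x
lastOf x (y ∷ ys) = lastOf y ys

end : ∀ {A : Set} → List⁺ A → A
end (x ∷ xs) = lastOf x xs

lastOf-snoc : ∀ {A : Set} (x : A) ys y → lastOf x (ys ++ [ y ]) ≡ y
lastOf-snoc x []       y = refl
lastOf-snoc x (z ∷ ys) y = lastOf-snoc z ys y

last≡end : ∀ {A : Set} (c : List⁺ A) → last c ≡ end c
last≡end (x ∷ xs) with initLast xs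
... | []       = refl
... | ys ∷ʳ′ y = sym (lastOf-snoc x ys y)

-- `integrate a x` is the word that starts with the letter a and whose
-- successive runs have the lengths listed by x; it inverts run-length encoding.
integrate : Letter → Word → Word
integrate a []        = []
integrate a (one ∷ x) = a ∷ integrate (other a) x
integrate a (two ∷ x) = a ∷ a ∷ integrate (other a) x

integrate-cons : ∀ a c x → integrate a (c ∷ x) ≡ replicate (len c) a ++ integrate (other a) x
integrate-cons a one x = refl
integrate-cons a two x = refl

integrate-head : ∀ a x → x ≢ [] → StartsWith a (integrate a x)
integrate-head a []        x≢[] = ⊥-elim (x≢[] refl)
integrate-head a (one ∷ x) _    = _ , refl
integrate-head a (two ∷ x) _    = _ , refl

runWord : Word → Maybe Word
runWord w = lengthsToWord (runs w)

lengthsToWord-map-len : ∀ x → lengthsToWord (map len x) ≡ just x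
lengthsToWord-map-len []        = refl
lengthsToWord-map-len (one ∷ x) rewrite lengthsToWord-map-len x = refl
lengthsToWord-map-len (two ∷ x) rewrite lengthsToWord-map-len x = refl

runsFrom-integrate : ∀ a n x → runsFrom a n (integrate (other a) x) ≡ n ∷ map len x
runsFrom-integrate a   n []        = refl
runsFrom-integrate one n (one ∷ x) = cong (n ∷_) (runsFrom-integrate two 1 x)
runsFrom-integrate two n (one ∷ x) = cong (n ∷_) (runsFrom-integrate one 1 x)
runsFrom-integrate one n (two ∷ x) = cong (n ∷_) (runsFrom-integrate two 2 x)
runsFrom-integrate two n (two ∷ x) = cong (n ∷_) (runsFrom-integrate one 2 x)

runWord-integrate : ∀ a x → runWord (integrate a x) ≡ just x
runWord-integrate a   []        = refl
runWord-integrate one (one ∷ x) rewrite runsFrom-integrate one 1 x | lengthsToWord-map-len x = refl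
runWord-integrate two (one ∷ x) rewrite runsFrom-integrate two 1 x | lengthsToWord-map-len x = refl
runWord-integrate one (two ∷ x) rewrite runsFrom-integrate one 2 x | lengthsToWord-map-len x = refl
runWord-integrate two (two ∷ x) rewrite runsFrom-integrate two 2 x | lengthsToWord-map-len x = refl

integrate-injective : ∀ a {x y} → integrate a x ≡ integrate a y → x ≡ y
integrate-injective a {x} {y} e with trans (sym (runWord-integrate a x)) (trans (cong runWord e) (runWord-integrate a y))
... | refl = refl

D-integrate : ∀ a x → D (integrate a x) ≡ just (trim x)
D-integrate a x rewrite runWord-integrate a x = refl

lengthsToWord-cons : ∀ n ns x → lengthsToWord (n ∷ ns) ≡ just x →
  ∃₂ λ c x′ → x ≡ c ∷ x′ × lengthsToWord ns ≡ just x′ × n ≡ len c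
lengthsToWord-cons 1 ns x e with lengthsToWord ns
... | just x′ with refl ← e = one , x′ , refl , refl , refl
lengthsToWord-cons 2 ns x e with lengthsToWord ns
... | just x′ with refl ← e = two , x′ , refl , refl , refl

replicate-snoc : ∀ n (a : Letter) u → replicate n a ++ a ∷ u ≡ replicate (suc n) a ++ u
replicate-snoc zero    a u = refl
replicate-snoc (suc n) a u = cong (a ∷_) (replicate-snoc n a u)

-- Run-length encoding is inverted by integration: a word aⁿu whose run
-- lengths (starting with the pending run aⁿ) form the word x equals `integrate a x`.
runsFrom-inverse : ∀ a n u x → lengthsToWord (runsFrom a n u) ≡ just x → replicate n a ++ u ≡ integrate a x
runsFrom-inverse a n [] x e with lengthsToWord-cons n [] x e
... | c , [] , refl , _ , refl = sym (integrate-cons a c [])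
runsFrom-inverse one n (one ∷ u) x e = trans (replicate-snoc n one u) (runsFrom-inverse one (suc n) u x e)
runsFrom-inverse two n (two ∷ u) x e = trans (replicate-snoc n two u) (runsFrom-inverse two (suc n) u x e)
runsFrom-inverse one n (two ∷ u) x e with lengthsToWord-cons n _ x e
... | c , x′ , refl , e′ , refl =
  trans (cong (replicate (len c) one ++_) (runsFrom-inverse two 1 u x′ e′)) (sym (integrate-cons one c x′))
runsFrom-inverse two n (one ∷ u) x e with lengthsToWord-cons n _ x e
... | c , x′ , refl , e′ , refl =
  trans (cong (replicate (len c) two ++_) (runsFrom-inverse one 1 u x′ e′)) (sym (integrate-cons two c x′))

D-inverse : ∀ a u v → D (a ∷ u) ≡ just v → ∃ λ x → a ∷ u ≡ integrate a x × trim x ≡ v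
D-inverse a u v e with runWord (a ∷ u) in r
... | just x with refl ← e = x , runsFrom-inverse a 1 u x r , refl

-- The letter of the run that follows the runs y in `integrate a y`.
runLetter : Letter → Word → Letter
runLetter a []      = a
runLetter a (_ ∷ y) = runLetter (other a) y

runLetter-snoc : ∀ a y c → runLetter a (y ++ [ c ]) ≡ other (runLetter a y)
runLetter-snoc a []      c = refl
runLetter-snoc a (_ ∷ y) c = runLetter-snoc (other a) y c

integrate-snoc-one : ∀ a y → integrate a (y ++ [ one ]) ≡ integrate a y ++ [ runLetter a y ]
integrate-snoc-one a []        = refl
integrate-snoc-one a (one ∷ y) = cong (a ∷_) (integrate-snoc-one (other a) y)
integrate-snoc-one a (two ∷ y) = cong (λ z → a ∷ a ∷ z) (integrate-snoc-one (other a) y)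

integrate-snoc-two : ∀ a y → integrate a (y ++ [ two ]) ≡ integrate a (y ++ [ one ]) ++ [ runLetter a y ]
integrate-snoc-two a []        = refl
integrate-snoc-two a (one ∷ y) = cong (a ∷_) (integrate-snoc-two (other a) y)
integrate-snoc-two a (two ∷ y) = cong (λ z → a ∷ a ∷ z) (integrate-snoc-two (other a) y)

≺-snoc-one : ∀ a y → integrate a y ≺ integrate a (y ++ [ one ])
≺-snoc-one a y = runLetter a y , integrate-snoc-one a y

≺-snoc-two : ∀ a y → integrate a (y ++ [ one ]) ≺ integrate a (y ++ [ two ])
≺-snoc-two a y = runLetter a y , integrate-snoc-two a y

-- Height, recursively: w has height k+1 iff it is nonempty and its derivative
-- has height k.  This is equivalent to `P k w` but far easier to work with.
Ht : ℕ → Word → Set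
Ht zero    w = w ≡ []
Ht (suc k) w = w ≢ [] × ∃ λ v → D w ≡ just v × Ht k v

just-injective : ∀ {x y : Word} → just x ≡ just y → x ≡ y
just-injective refl = refl

Dⁱ-suc : ∀ j w → Dⁱ (suc j) w ≡ (D w >>= Dⁱ j)
Dⁱ-suc zero w with D w
... | just v  = refl
... | nothing = refl
Dⁱ-suc (suc j) w rewrite Dⁱ-suc j w with D w
... | just v  = refl
... | nothing = refl

Dⁱ-[] : ∀ j → Dⁱ j [] ≡ just []
Dⁱ-[] zero    = refl
Dⁱ-[] (suc j) rewrite Dⁱ-[] j = refl

Dⁱ-shift : ∀ {w v} → D w ≡ just v → ∀ j → Dⁱ j v ≡ Dⁱ (suc j) w
Dⁱ-shift {w} e j = sym (trans (Dⁱ-suc j w) (cong (_>>= Dⁱ j) e))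

Ht⇒P : ∀ k w → Ht k w → P k w
Ht⇒P zero    w refl = (λ j → [] , Dⁱ-[] j) , refl , λ _ ()
Ht⇒P (suc k) w (w≢[] , v , e , h) with Ht⇒P k v h
... | smooth , hk , minimal = smooth′ , trans (sym (Dⁱ-shift e k)) hk , minimal′
  where
  smooth′ : Smooth w
  smooth′ zero    = w , refl
  smooth′ (suc j) = proj₁ (smooth j) , trans (sym (Dⁱ-shift e j)) (proj₂ (smooth j))
  minimal′ : ∀ j → j < suc k → Dⁱ j w ≢ just []
  minimal′ zero    _         e₀ = w≢[] (just-injective e₀)
  minimal′ (suc j) (s≤s j<k) eⱼ = minimal j j<k (trans (Dⁱ-shift e j) eⱼ)

P⇒Ht : ∀ k w → P k w → Ht k w
P⇒Ht zero    w (_ , h , _) = just-injective h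
P⇒Ht (suc k) w (smooth , h , minimal) with smooth 1
... | v , e = w≢[] , v , e , P⇒Ht k v (smooth′ , trans (Dⁱ-shift e k) h , minimal′)
  where
  w≢[] : w ≢ []
  w≢[] refl = minimal zero (s≤s z≤n) refl
  smooth′ : Smooth v
  smooth′ j = proj₁ (smooth (suc j)) , trans (Dⁱ-shift e j) (proj₂ (smooth (suc j)))
  minimal′ : ∀ j → j < k → Dⁱ j v ≢ just []
  minimal′ j j<k eⱼ = minimal (suc j) (s≤s j<k) (trans (sym (Dⁱ-shift e j)) eⱼ)

Ht? : ∀ k w → Dec (Ht k w)
Ht? zero    []      = yes refl
Ht? zero    (_ ∷ _) = no λ ()
Ht? (suc k) []      = no λ h → proj₁ h refl
Ht? (suc k) (a ∷ w) with D (a ∷ w)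
... | nothing = no λ { (_ , _ , () , _) }
... | just v with Ht? k v
...   | yes h = yes ((λ ()) , v , refl , h)
...   | no ¬h = no λ { (_ , _ , refl , h) → ¬h h }

P? : ∀ k w → Dec (P k w)
P? k w = map′ (Ht⇒P k w) (P⇒Ht k w) (Ht? k w)

integrate-Ht : ∀ k a x → x ≢ [] → Ht k (trim x) → Ht (suc k) (integrate a x)
integrate-Ht k a x x≢[] h = integrate-≢[] x x≢[] , trim x , D-integrate a x , h
  where
  integrate-≢[] : ∀ x → x ≢ [] → integrate a x ≢ []
  integrate-≢[] x x≢[] e = ∷≢[] (trans (sym (proj₂ (integrate-head a x x≢[]))) e)

Ht-integrate : ∀ k a x → Ht (suc k) (integrate a x) → Ht k (trim x)
Ht-integrate k a x (_ , v , e , h) = subst (Ht k) (just-injective (trans (sym e) (D-integrate a x))) h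

Ht-derive : ∀ {k a z w} → integrate a z ≡ w → Ht (suc k) w → Ht k (trim z)
Ht-derive {k} {a} {z} e h = Ht-integrate k a z (subst (Ht (suc k)) (sym e) h)

non-differentiable : ∀ {k w} → D w ≡ nothing → ¬ Ht (suc k) w
non-differentiable e (_ , _ , e′ , _) with trans (sym e) e′
... | ()

Ht-view : ∀ k w → Ht (suc k) w → ∃₂ λ a x → w ≡ integrate a x × x ≢ [] × Ht k (trim x)
Ht-view k []      (w≢[] , _) = ⊥-elim (w≢[] refl)
Ht-view k (a ∷ u) (_ , v , e , h) with D-inverse a u v e
... | x , w≡ , refl = a , x , w≡ , x≢[] , h
  where
  x≢[] : x ≢ []
  x≢[] refl = ∷≢[] w≡

-- dropLast removes a final letter 1, so that trim x = dropLast (dropOne x).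
dropLast : Word → Word
dropLast x = reverse (dropOne (reverse x))

dropLast-one : ∀ y → dropLast (y ++ [ one ]) ≡ y
dropLast-one y rewrite reverse-++ y [ one ] = reverse-involutive y

dropLast-two : ∀ y → dropLast (y ++ [ two ]) ≡ y ++ [ two ]
dropLast-two y = begin
  reverse (dropOne (reverse (y ++ [ two ]))) ≡⟨ cong (λ z → reverse (dropOne z)) (reverse-++ y [ two ]) ⟩
  reverse (two ∷ reverse y)                  ≡⟨ cong reverse (sym (reverse-++ y [ two ])) ⟩
  reverse (reverse (y ++ [ two ]))           ≡⟨ reverse-involutive _ ⟩
  y ++ [ two ]                               ∎
  where open ≡-Reasoning

dropLast-[] : ∀ z → dropLast z ≡ [] → z ≡ [] ⊎ z ≡ [ one ]
dropLast-[] z e with snocView z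
... | inj₁ refl = inj₁ refl
... | inj₂ (y , one , refl) = inj₂ (cong (_++ [ one ]) (trans (sym (dropLast-one y)) e))
... | inj₂ (y , two , refl) = ⊥-elim (snoc≢[] y two (trans (sym (dropLast-two y)) e))

-- The ways a word v sits inside a word x with trim x = v: the letters removed
-- on the left (p) and on the right (s) of x = p ++ v ++ s.
LeftPad : Word → Word → Set
LeftPad p v = p ≡ [ one ] ⊎ (p ≡ [] × StartsWith two v)

RightPad : Word → Word → Set
RightPad s v = s ≡ [ one ] ⊎ (s ≡ [] × EndsWith two v)

trim-pad : ∀ {p v s} → LeftPad p v → RightPad s v → trim (p ++ v ++ s) ≡ v
trim-pad {p} {v} {s} lp rp = trans (cong dropLast (dropOne-pad lp)) (dropLast-pad rp)
  where
  dropOne-pad : LeftPad p v → dropOne (p ++ v ++ s) ≡ v ++ s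
  dropOne-pad (inj₁ refl)              = refl
  dropOne-pad (inj₂ (refl , _ , refl)) = refl
  dropLast-pad : RightPad s v → dropLast (v ++ s) ≡ v
  dropLast-pad (inj₁ refl)              = dropLast-one v
  dropLast-pad (inj₂ (refl , y , refl)) = trans (cong dropLast (++-identityʳ (y ++ [ two ]))) (dropLast-two y)

dropOne-split : ∀ x → x ≢ [] → ∃ λ p → x ≡ p ++ dropOne x × LeftPad p (dropOne x)
dropOne-split []        x≢[] = ⊥-elim (x≢[] refl)
dropOne-split (one ∷ z) _    = [ one ] , refl , inj₁ refl
dropOne-split (two ∷ z) _    = [] , refl , inj₂ (refl , z , refl)

dropLast-split : ∀ z → dropLast z ≢ [] → ∃ λ s → z ≡ dropLast z ++ s × RightPad s (dropLast z)
dropLast-split z ne with snocView z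
... | inj₁ refl = ⊥-elim (ne refl)
... | inj₂ (y , one , refl) rewrite dropLast-one y = [ one ] , refl , inj₁ refl
... | inj₂ (y , two , refl) rewrite dropLast-two y = [] , sym (++-identityʳ _) , inj₂ (refl , y , refl)

LeftPad-prefix : ∀ {p} v s → v ≢ [] → LeftPad p (v ++ s) → LeftPad p v
LeftPad-prefix v        s _    (inj₁ e)                 = inj₁ e
LeftPad-prefix []       s v≢[] (inj₂ _)                 = ⊥-elim (v≢[] refl)
LeftPad-prefix (c ∷ v)  s _    (inj₂ (refl , t , refl)) = inj₂ (refl , v , refl)

trim-decompose : ∀ x → trim x ≢ [] →
  ∃₂ λ p s → x ≡ p ++ trim x ++ s × LeftPad p (trim x) × RightPad s (trim x)
trim-decompose x trim≢[] with dropOne-split x (λ { refl → trim≢[] refl }) | dropLast-split (dropOne x) trim≢[]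
... | p , ex , lp | s , ez , rp =
  p , s , trans ex (cong (p ++_) ez) , LeftPad-prefix (trim x) s trim≢[] (subst (LeftPad p) ez lp) , rp

trim-empty : ∀ x → x ≢ [] → trim x ≡ [] → x ≡ [ one ] ⊎ x ≡ one ∷ one ∷ []
trim-empty []        x≢[] _ = ⊥-elim (x≢[] refl)
trim-empty (one ∷ z) _    e with dropLast-[] z e
... | inj₁ refl = inj₁ refl
... | inj₂ refl = inj₂ refl
trim-empty (two ∷ z) _    e with dropLast-[] (two ∷ z) e
... | inj₁ ()
... | inj₂ ()

trim-predecessor : ∀ {p} v r → LeftPad p (v ++ r) → trim (p ++ v ++ [ one ]) ≡ v
trim-predecessor v         r (inj₁ refl)            = dropLast-one v
trim-predecessor []        r (inj₂ (refl , _))      = refl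
trim-predecessor (two ∷ v) r (inj₂ (refl , _))      = dropLast-one (two ∷ v)
trim-predecessor (one ∷ v) r (inj₂ (refl , _ , ()))

long-run : ∀ c n t → lengthsToWord (runsFrom c (3 + n) t) ≡ nothing
long-run one n []        = refl
long-run two n []        = refl
long-run one n (one ∷ t) = long-run one (suc n) t
long-run two n (two ∷ t) = long-run two (suc n) t
long-run one n (two ∷ t) = refl
long-run two n (one ∷ t) = refl

lengthsToWord-++ : ∀ ns ms → lengthsToWord ms ≡ nothing → lengthsToWord (ns ++ ms) ≡ nothing
lengthsToWord-++ []                      ms e = e
lengthsToWord-++ (0 ∷ ns)                ms e = refl
lengthsToWord-++ (1 ∷ ns)                ms e rewrite lengthsToWord-++ ns ms e = refl
lengthsToWord-++ (2 ∷ ns)                ms e rewrite lengthsToWord-++ ns ms e = refl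
lengthsToWord-++ (suc (suc (suc n)) ∷ ns) ms e = refl

runsFrom-++ : ∀ a n u r → ∃₂ λ ns b → ∃ λ m → runsFrom a n (u ++ r) ≡ ns ++ runsFrom b m r
runsFrom-++ a   n []        r = [] , a , n , refl
runsFrom-++ one n (one ∷ u) r = runsFrom-++ one (suc n) u r
runsFrom-++ two n (two ∷ u) r = runsFrom-++ two (suc n) u r
runsFrom-++ one n (two ∷ u) r with runsFrom-++ two 1 u r
... | ns , b , m , e = n ∷ ns , b , m , cong (n ∷_) e
runsFrom-++ two n (one ∷ u) r with runsFrom-++ one 1 u r
... | ns , b , m , e = n ∷ ns , b , m , cong (n ∷_) e

D-triple : ∀ u ℓ t → D (u ++ ℓ ∷ ℓ ∷ ℓ ∷ t) ≡ nothing
D-triple u ℓ t = D-undefined (u ++ ℓ ∷ ℓ ∷ ℓ ∷ t) (runWord-triple u ℓ)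
  where
  D-undefined : ∀ w → runWord w ≡ nothing → D w ≡ nothing
  D-undefined w e rewrite e = refl
  pending-triple : ∀ b m ℓ → lengthsToWord (runsFrom b m (ℓ ∷ ℓ ∷ ℓ ∷ t)) ≡ nothing
  pending-triple one m one = long-run one m t
  pending-triple two m two = long-run two m t
  pending-triple one m two = lengthsToWord-++ [ m ] _ (long-run two 0 t)
  pending-triple two m one = lengthsToWord-++ [ m ] _ (long-run one 0 t)
  runWord-triple : ∀ u ℓ → runWord (u ++ ℓ ∷ ℓ ∷ ℓ ∷ t) ≡ nothing
  runWord-triple []      one = long-run one 0 t
  runWord-triple []      two = long-run two 0 t
  runWord-triple (a ∷ u) ℓ with runsFrom-++ a 1 u (ℓ ∷ ℓ ∷ ℓ ∷ t)
  ... | ns , b , m , e = trans (cong lengthsToWord e) (lengthsToWord-++ ns _ (pending-triple b m ℓ))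

D-extend-run-two : ∀ a y → D (integrate a (y ++ [ two ]) ++ [ runLetter a y ]) ≡ nothing
D-extend-run-two a y = trans (cong D triple) (D-triple (integrate a y) m [])
  where
  m = runLetter a y
  open ≡-Reasoning
  triple : integrate a (y ++ [ two ]) ++ [ m ] ≡ integrate a y ++ m ∷ m ∷ m ∷ []
  triple = begin
    integrate a (y ++ [ two ]) ++ [ m ]              ≡⟨ cong (_++ [ m ]) (integrate-snoc-two a y) ⟩
    (integrate a (y ++ [ one ]) ++ [ m ]) ++ [ m ]   ≡⟨ cong (λ z → (z ++ [ m ]) ++ [ m ]) (integrate-snoc-one a y) ⟩
    ((integrate a y ++ [ m ]) ++ [ m ]) ++ [ m ]     ≡⟨ ++-assoc (integrate a y ++ [ m ]) [ m ] [ m ] ⟩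
    (integrate a y ++ [ m ]) ++ m ∷ m ∷ []           ≡⟨ ++-assoc (integrate a y) [ m ] (m ∷ m ∷ []) ⟩
    integrate a y ++ m ∷ m ∷ m ∷ []                  ∎

integrate-extend-run-one : ∀ a y →
  integrate a ((y ++ [ one ]) ++ [ one ]) ≡ integrate a (y ++ [ one ]) ++ [ other (runLetter a y) ]
integrate-extend-run-one a y =
  trans (integrate-snoc-one a (y ++ [ one ])) (cong (λ c → integrate a (y ++ [ one ]) ++ [ c ]) (runLetter-snoc a y one))

-- At height k+1 write w = integrate a x.  If x ends in 2, one extension contains
-- a triple; if x ends in 1, the extensions are integrals of y2 and y11, and
-- their trims are extensions of a word of height k (`noBranch-trim`).
noBranch : ∀ k w → Ht k w → Ht k (w ++ [ one ]) → Ht k (w ++ [ two ]) → ⊥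
noBranch-trim : ∀ k y → Ht k (trim (y ++ [ one ])) →
  Ht k (trim ((y ++ [ one ]) ++ [ one ])) → Ht k (trim (y ++ [ two ])) → ⊥

noBranch zero    w _ h₁ _ = snoc≢[] w one h₁
noBranch (suc k) w h h₁ h₂ with Ht-view k w h
... | a , x , refl , x≢[] , hx with snocView x
...   | inj₁ refl = x≢[] refl
...   | inj₂ (y , two , refl) with runLetter a y | D-extend-run-two a y
...     | one | e = non-differentiable e h₁
...     | two | e = non-differentiable e h₂
noBranch (suc k) w h h₁ h₂ | a , x , refl , x≢[] , hx | inj₂ (y , one , refl)
  with runLetter a y | integrate-snoc-two a y | integrate-extend-run-one a y
... | one | e₂ | e₁₁ = noBranch-trim k y hx (Ht-derive e₁₁ h₂) (Ht-derive e₂ h₁)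
... | two | e₂ | e₁₁ = noBranch-trim k y hx (Ht-derive e₁₁ h₁) (Ht-derive e₂ h₂)

noBranch-trim zero    []        _ _   ()
noBranch-trim (suc k) []        _ h₁₁ _  = proj₁ h₁₁ refl
noBranch-trim k       (one ∷ z) h h₁₁ h₂ =
  noBranch k z (subst (Ht k) (dropLast-one z) h)
               (subst (Ht k) (dropLast-one (z ++ [ one ])) h₁₁) (subst (Ht k) (dropLast-two z) h₂)
noBranch-trim k       (two ∷ z) h h₁₁ h₂ =
  noBranch k (two ∷ z) (subst (Ht k) (dropLast-one (two ∷ z)) h)
               (subst (Ht k) (dropLast-one (two ∷ z ++ [ one ])) h₁₁) (subst (Ht k) (dropLast-two (two ∷ z)) h₂)

heightBound : ℕ → ℕ
heightBound zero    = 0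
heightBound (suc k) = 2 * (2 + heightBound k)

length-integrate : ∀ a x → length (integrate a x) ≤ 2 * length x
length-integrate a []        = z≤n
length-integrate a (one ∷ x) = s≤s (≤-trans (length-integrate (other a) x) (+-monoʳ-≤ (length x) (n≤1+n _)))
length-integrate a (two ∷ x) =
  s≤s (≤-trans (s≤s (length-integrate (other a) x)) (≤-reflexive (sym (+-suc (length x) (length x + 0)))))

length-dropOne : ∀ x → length x ≤ suc (length (dropOne x))
length-dropOne []        = z≤n
length-dropOne (one ∷ x) = ≤-refl
length-dropOne (two ∷ x) = n≤1+n _

length-trim : ∀ x → length x ≤ 2 + length (trim x)
length-trim x = begin
  length x                                        ≤⟨ length-dropOne x ⟩
  suc (length (dropOne x))                        ≡⟨ cong suc (sym (length-reverse (dropOne x))) ⟩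
  suc (length (reverse (dropOne x)))              ≤⟨ s≤s (length-dropOne (reverse (dropOne x))) ⟩
  2 + length (dropOne (reverse (dropOne x)))      ≡⟨ cong (2 +_) (sym (length-reverse (dropOne (reverse (dropOne x))))) ⟩
  2 + length (trim x)                             ∎
  where open ≤-Reasoning

Ht-bounded : ∀ k w → Ht k w → length w ≤ heightBound k
Ht-bounded zero    w refl = z≤n
Ht-bounded (suc k) w h with Ht-view k w h
... | a , x , refl , _ , hx =
  ≤-trans (length-integrate a x) (*-monoʳ-≤ 2 (≤-trans (length-trim x) (+-monoʳ-≤ 2 (Ht-bounded k (trim x) hx))))

-- Maximal chains for an abstract class S of words that is decidable, never
-- branches and has bounded length.  Growing a chain from an initial word
-- (an S-word without S-predecessor) by the unique S-extensions gives a maximal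
-- chain; every maximal chain arises so from its head, and every S-word is
-- reached from exactly one initial word.  Hence maximal chains partition S
-- and are in bijection with the initial words.
module MaximalChains
  (S : Word → Set) (S? : ∀ w → Dec (S w))
  (noBranching : ∀ w → S w → S (w ++ [ one ]) → S (w ++ [ two ]) → ⊥)
  (B : ℕ) (bounded : ∀ w → S w → length w ≤ B)
  where

  IsMaximalChain : List⁺ Word → Set
  IsMaximalChain c = All S (toList c) × Linked _≺_ (toList c) ×
    (∀ v → S v → ¬ (v ≺ head c)) × (∀ v → S v → ¬ (last c ≺ v))

  Initial : Word → Set
  Initial s = S s × (∀ v → S v → ¬ (v ≺ s))

  extension-unique : ∀ {w} α β → S w → S (w ++ [ α ]) → S (w ++ [ β ]) → α ≡ β
  extension-unique one one _ _  _  = refl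
  extension-unique two two _ _  _  = refl
  extension-unique one two s s₁ s₂ = ⊥-elim (noBranching _ s s₁ s₂)
  extension-unique two one s s₂ s₁ = ⊥-elim (noBranching _ s s₁ s₂)

  data Next (w : Word) : Set where
    stop : (∀ α → ¬ S (w ++ [ α ])) → Next w
    step : ∀ α → S (w ++ [ α ]) → Next w

  next : ∀ w → Next w
  next w with S? (w ++ [ one ]) | S? (w ++ [ two ])
  ... | yes s₁ | _      = step one s₁
  ... | no _   | yes s₂ = step two s₂
  ... | no ¬s₁ | no ¬s₂ = stop λ { one → ¬s₁ ; two → ¬s₂ }

  grow : ℕ → Word → List⁺ Word
  grow zero    w = w ∷ []
  grow (suc f) w with next w
  ... | stop _   = w ∷ []
  ... | step α _ = w ∷⁺ grow f (w ++ [ α ])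

  grow-head : ∀ f w → head (grow f w) ≡ w
  grow-head zero    w = refl
  grow-head (suc f) w with next w
  ... | stop _   = refl
  ... | step _ _ = refl

  grow-S : ∀ f w → S w → All S (toList (grow f w))
  grow-S zero    w s = s ∷ []
  grow-S (suc f) w s with next w
  ... | stop _    = s ∷ []
  ... | step α sα = s ∷ grow-S f (w ++ [ α ]) sα

  grow-linked : ∀ f w → Linked _≺_ (toList (grow f w))
  grow-linked zero    w = [-]
  grow-linked (suc f) w with next w
  ... | stop _   = [-]
  ... | step α _ = (α , grow-head f (w ++ [ α ])) ∷ grow-linked f (w ++ [ α ])

  -- f steps suffice from w once length w + f reaches the length bound.
  Enough : ℕ → Word → Set
  Enough f w = B ≤ length w + f

  enough-step : ∀ {f} w α → Enough (suc f) w → Enough f (w ++ [ α ])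
  enough-step {f} w α = subst (B ≤_) (trans (+-suc (length w) f) (cong (_+ f) (sym (length-snoc w α))))

  out-of-fuel : ∀ w α → Enough 0 w → ¬ S (w ++ [ α ])
  out-of-fuel w α e s = 1+n≰n (begin
    suc (length w)      ≡⟨ sym (length-snoc w α) ⟩
    length (w ++ [ α ]) ≤⟨ bounded _ s ⟩
    B                   ≤⟨ e ⟩
    length w + 0        ≡⟨ +-identityʳ _ ⟩
    length w            ∎)
    where open ≤-Reasoning

  grow-end : ∀ f w → Enough f w → ∀ v → S v → ¬ (end (grow f w) ≺ v)
  grow-end zero    w e v sv (α , refl) = out-of-fuel w α e sv
  grow-end (suc f) w e v sv r with next w
  grow-end (suc f) w e v sv (α , refl) | stop ¬ext = ¬ext α sv
  grow-end (suc f) w e v sv r          | step β _  = grow-end f (w ++ [ β ]) (enough-step w β e) v sv r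

  grow-unique : ∀ f u us → All S (u ∷ us) → Linked _≺_ (u ∷ us) →
    (∀ v → S v → ¬ (lastOf u us ≺ v)) → Enough f u → u ∷ us ≡ grow f u
  grow-unique zero    u []       _ _ _ _ = refl
  grow-unique (suc f) u []       _ _ ¬ext _ with next u
  ... | stop _    = refl
  ... | step β sβ = ⊥-elim (¬ext _ sβ (β , refl))
  grow-unique zero    u (_ ∷ us) (_ ∷ su′ ∷ _) ((α , refl) ∷ _) _ e = ⊥-elim (out-of-fuel u α e su′)
  grow-unique (suc f) u (_ ∷ us) (su ∷ su′ ∷ S-us) ((α , refl) ∷ l) ¬ext e with next u
  ... | stop ¬ext′ = ⊥-elim (¬ext′ α su′)
  ... | step β sβ with extension-unique α β su su′ sβ
  ...   | refl = cong (u ∷⁺_) (grow-unique f (u ++ [ α ]) us (su′ ∷ S-us) l ¬ext (enough-step u α e))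

  data Reach (s : Word) : Word → Set where
    here : Reach s s
    snoc : ∀ {v w} → Reach s v → v ≺ w → S w → Reach s w

  reach-S : ∀ {s w} → S s → Reach s w → S w
  reach-S ss here          = ss
  reach-S ss (snoc _ _ sw) = sw

  reach-unique : ∀ {s s′ w} → Initial s → Initial s′ → Reach s w → Reach s′ w → s ≡ s′
  reach-unique i i′ here         here           = refl
  reach-unique i i′ here         (snoc p′ r′ _) = ⊥-elim (proj₂ i _ (reach-S (proj₁ i′) p′) r′)
  reach-unique i i′ (snoc p r _) here           = ⊥-elim (proj₂ i′ _ (reach-S (proj₁ i) p) r)
  reach-unique i i′ (snoc p r _) (snoc p′ r′ _) with ≺-unique r r′
  ... | refl = reach-unique i i′ p p′

  grow-extend : ∀ f u {v w} → S u → Enough f u → v ∈ toList (grow f u) → v ≺ w → S w → w ∈ toList (grow f u)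
  grow-extend zero    u su e (here refl) (α , refl) sw = ⊥-elim (out-of-fuel u α e sw)
  grow-extend (suc f) u su e m r sw with next u
  grow-extend (suc f) u su e (here refl) (α , refl) sw | stop ¬ext = ⊥-elim (¬ext α sw)
  grow-extend (suc f) u su e (here refl) (α , refl) sw | step β sβ with extension-unique α β su sw sβ
  ... | refl = there (here (sym (grow-head f (u ++ [ α ]))))
  grow-extend (suc f) u su e (there m) r sw | step β sβ =
    there (grow-extend f (u ++ [ β ]) sβ (enough-step u β e) m r sw)

  reach-grow : ∀ f s {w} → S s → Enough f s → Reach s w → w ∈ toList (grow f s)
  reach-grow f s ss e here          = here (sym (grow-head f s))
  reach-grow f s ss e (snoc p r sw) = grow-extend f s ss e (reach-grow f s ss e p) r sw

  reach-prepend : ∀ {u u′ w} → u ≺ u′ → S u′ → Reach u′ w → Reach u w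
  reach-prepend r su′ here           = snoc here r su′
  reach-prepend r su′ (snoc p r′ sw) = snoc (reach-prepend r su′ p) r′ sw

  chain-reach : ∀ u us {w} → All S (u ∷ us) → Linked _≺_ (u ∷ us) → w ∈ (u ∷ us) → Reach u w
  chain-reach u us        _                    _       (here refl) = here
  chain-reach u (u′ ∷ us) (_ ∷ S-us@(su′ ∷ _)) (r ∷ l) (there m)   = reach-prepend r su′ (chain-reach u′ us S-us l m)

  -- Every S-word is reached from an initial word: strip final letters while staying in S.
  descend : ∀ {w} → Reverse w → S w → ∃ λ s → Initial s × Reach s w
  descend []              sw = [] , (sw , λ v _ (α , e) → snoc≢[] v α (sym e)) , here
  descend (v ∶ rv ∶ʳ α) sw with S? v
  ... | no ¬sv = v ++ [ α ] , (sw , λ v′ sv′ r → ¬sv (subst S (≺-unique r (α , refl)) sv′)) , here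
  ... | yes sv with descend rv sv
  ...   | s , init , p = s , init , snoc p (α , refl) sw

  chainFrom : Word → List⁺ Word
  chainFrom = grow B

  enough : ∀ w → Enough B w
  enough w = m≤n+m B (length w)

  chainFrom-maximal : ∀ s → Initial s → IsMaximalChain (chainFrom s)
  chainFrom-maximal s (ss , ¬pred) =
    grow-S B s ss , grow-linked B s ,
    (λ v sv r → ¬pred v sv (subst (v ≺_) (grow-head B s) r)) ,
    (λ v sv r → grow-end B s (enough s) v sv (subst (_≺ v) (last≡end (chainFrom s)) r))

  maximal-initial : ∀ c → IsMaximalChain c → Initial (head c)
  maximal-initial (u ∷ us) (su ∷ _ , _ , ¬pred , _) = su , ¬pred

  maximal-chainFrom : ∀ c → IsMaximalChain c → c ≡ chainFrom (head c)
  maximal-chainFrom (u ∷ us) (S-c , l , _ , ¬ext) =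
    grow-unique B u us S-c l (λ v sv r → ¬ext v sv (subst (_≺ v) (sym (last≡end (u ∷ us))) r)) (enough u)

  partition : ∀ w → S w → ∃ λ c → IsMaximalChain c × w ∈ toList c ×
    (∀ c′ → IsMaximalChain c′ → w ∈ toList c′ → c′ ≡ c)
  partition w sw with descend (reverseView w) sw
  ... | s , init , p = chainFrom s , chainFrom-maximal s init , reach-grow B s (proj₁ init) (enough s) p , unique
    where
    unique : ∀ c′ → IsMaximalChain c′ → w ∈ toList c′ → c′ ≡ chainFrom s
    unique c′@(u ∷ us) max m = trans (maximal-chainFrom c′ max)
      (cong chainFrom (reach-unique (maximal-initial c′ max) init (chain-reach u us (proj₁ max) (proj₁ (proj₂ max)) m) p))

  enumerate : (I : List Word) → Unique I → (∀ s → Initial s ⇔ s ∈ I) →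
    ∃ λ H → Unique H × (∀ c → IsMaximalChain c ⇔ c ∈ H) × length H ≡ length I
  enumerate I unique-I initial⇔ = map chainFrom I , unique-H , maximal⇔ , length-map chainFrom I
    where
    unique-H : Unique (map chainFrom I)
    unique-H = Unique.map⁺ (λ {s} {s′} e → trans (sym (grow-head B s)) (trans (cong head e) (grow-head B s′))) unique-I
    maximal⇔ : ∀ c → IsMaximalChain c ⇔ c ∈ map chainFrom I
    maximal⇔ c = mk⇔
      (λ max → subst (_∈ map chainFrom I) (sym (maximal-chainFrom c max))
                 (∈-map⁺ chainFrom (Equivalence.to (initial⇔ (head c)) (maximal-initial c max))))
      (λ m → let s , s∈I , c≡ = ∈-map⁻ chainFrom m in
             subst IsMaximalChain (sym c≡) (chainFrom-maximal s (Equivalence.from (initial⇔ s) s∈I)))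

InitialHt : ℕ → Word → Set
InitialHt k s = Ht k s × (∀ v → Ht k v → ¬ (v ≺ s))

leftPads : Word → List Word
leftPads []        = []
leftPads (one ∷ _) = [ [ one ] ]
leftPads (two ∷ _) = [] ∷ [ one ] ∷ []

leftPads-sound : ∀ v {p} → p ∈ leftPads v → LeftPad p v
leftPads-sound (one ∷ t) (here refl)         = inj₁ refl
leftPads-sound (two ∷ t) (here refl)         = inj₂ (refl , t , refl)
leftPads-sound (two ∷ t) (there (here refl)) = inj₁ refl

leftPads-complete : ∀ v {p} → v ≢ [] → LeftPad p v → p ∈ leftPads v
leftPads-complete []        v≢[] _                        = ⊥-elim (v≢[] refl)
leftPads-complete (one ∷ t) _    (inj₁ refl)              = here refl
leftPads-complete (two ∷ t) _    (inj₁ refl)              = there (here refl)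
leftPads-complete (two ∷ t) _    (inj₂ (refl , _ , refl)) = here refl

-- The right pad of an initial word over a derivative ending in c: a final run
-- of length one if c = 1, nothing if c = 2.
closing : Letter → Word
closing one = [ one ]
closing two = []

closing-pad : ∀ v′ c → RightPad (closing c) (v′ ++ [ c ])
closing-pad v′ one = inj₁ refl
closing-pad v′ two = inj₂ (refl , v′ , refl)

-- The right pad determined by the last letter of v (the default for v = [] is irrelevant).
closingOf : Word → Word
closingOf v = closing (lastOf one v)

lift : Letter → Word → Word → Word
lift b v p = integrate b (p ++ v ++ closingOf v)

lifts : Word → List Word
lifts v = map (lift one v) (leftPads v) ++ map (lift two v) (leftPads v)

lift-∈ : ∀ b v {p} → p ∈ leftPads v → lift b v p ∈ lifts v
lift-∈ one v p∈ = ∈-++⁺ˡ (∈-map⁺ (lift one v) p∈)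
lift-∈ two v p∈ = ∈-++⁺ʳ (map (lift one v) (leftPads v)) (∈-map⁺ (lift two v) p∈)

∈-lifts : ∀ v {s} → s ∈ lifts v → ∃₂ λ b p → p ∈ leftPads v × s ≡ lift b v p
∈-lifts v s∈ with ∈-++⁻ (map (lift one v) (leftPads v)) s∈
... | inj₁ s∈₁ = let p , p∈ , e = ∈-map⁻ (lift one v) s∈₁ in one , p , p∈ , e
... | inj₂ s∈₂ = let p , p∈ , e = ∈-map⁻ (lift two v) s∈₂ in two , p , p∈ , e

lift-trim : ∀ v {p} → p ∈ leftPads v → trim (p ++ v ++ closingOf v) ≡ v
lift-trim v {p} p∈ with snocView v
... | inj₁ refl = ⊥-elim (∉[] p∈)
... | inj₂ (v′ , c , refl) rewrite lastOf-snoc one v′ c = trim-pad (leftPads-sound _ p∈) (closing-pad v′ c)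

lift-derivative : ∀ b v {p} → p ∈ leftPads v → D (lift b v p) ≡ just v
lift-derivative b v {p} p∈ = trans (D-integrate b (p ++ v ++ closingOf v)) (cong just (lift-trim v p∈))

lift-predecessor : ∀ b p v′ c → integrate b (p ++ v′ ++ [ one ]) ≺ integrate b (p ++ (v′ ++ [ c ]) ++ closing c)
lift-predecessor b p v′ one =
  subst (λ z → integrate b (p ++ v′ ++ [ one ]) ≺ integrate b z) (++-assoc p (v′ ++ [ one ]) [ one ])
    (≺-snoc-one b (p ++ v′ ++ [ one ]))
lift-predecessor b p v′ two =
  subst₂ (λ y z → integrate b y ≺ integrate b z)
    (++-assoc p v′ [ one ]) (trans (++-assoc p v′ [ two ]) (cong (p ++_) (sym (++-identityʳ _))))
    (≺-snoc-two b (p ++ v′))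

-- A lift of v has no predecessor of its height when v has none: the predecessor
-- of the lift of v′c has derivative v′, a predecessor of v.
lift-no-predecessor : ∀ k v b {p} → p ∈ leftPads v → (∀ u → Ht (suc k) u → ¬ (u ≺ v)) →
  ∀ u → Ht (suc (suc k)) u → ¬ (u ≺ lift b v p)
lift-no-predecessor k v b {p} p∈ ¬pred u hu r with snocView v
... | inj₁ refl = ⊥-elim (∉[] p∈)
... | inj₂ (v′ , c , refl) rewrite lastOf-snoc one v′ c with ≺-unique r (lift-predecessor b p v′ c)
...   | refl = ¬pred v′
        (subst (Ht (suc k)) (trim-predecessor v′ [ c ] (leftPads-sound _ p∈)) (Ht-integrate (suc k) b _ hu)) (c , refl)

lift-initial : ∀ k v b {p} → InitialHt (suc k) v → p ∈ leftPads v → InitialHt (suc (suc k)) (lift b v p)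
lift-initial k v b {p} (hv , ¬pred) p∈ =
  integrate-Ht (suc k) b (p ++ v ++ closingOf v) (≢[]-++ʳ p (≢[]-++ˡ (closingOf v) (proj₁ hv)))
    (subst (Ht (suc k)) (sym (lift-trim v p∈)) hv) ,
  lift-no-predecessor k v b p∈ ¬pred

-- The right pad of an initial word of height k+2 over v′c is `closing c`: a final
-- run of length one after a derivative ending in 2 would leave a predecessor
-- of the same height.
initial-closing : ∀ k a p v′ c r → LeftPad p (v′ ++ [ c ]) → RightPad r (v′ ++ [ c ]) →
  Ht (suc k) (v′ ++ [ c ]) → InitialHt (suc (suc k)) (integrate a (p ++ (v′ ++ [ c ]) ++ r)) → r ≡ closing c
initial-closing k a p v′ one r lp (inj₁ refl) _ _ = refl
initial-closing k a p v′ two r lp (inj₁ refl) hv (_ , ¬pred) =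
  ⊥-elim (¬pred (integrate a q) hq
    (subst (λ z → integrate a q ≺ integrate a z) (++-assoc p (v′ ++ [ two ]) [ one ]) (≺-snoc-one a q)))
  where
  q = p ++ v′ ++ [ two ]
  trim-q : trim q ≡ v′ ++ [ two ]
  trim-q = trans (cong (λ z → trim (p ++ z)) (sym (++-identityʳ (v′ ++ [ two ])))) (trim-pad lp (inj₂ (refl , v′ , refl)))
  hq : Ht (suc (suc k)) (integrate a q)
  hq = integrate-Ht (suc k) a q (≢[]-++ʳ p (snoc≢[] v′ two)) (subst (Ht (suc k)) (sym trim-q) hv)
initial-closing k a p v′ c r lp (inj₂ (refl , y , e)) _ _ with ∷ʳ-injective v′ y e
... | _ , refl = refl

-- The derivative of an initial word of height k+2 is initial: a predecessor v′
-- of its derivative v′c would yield the predecessor integrate a (p v′ 1).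
initial-derivative : ∀ k a p v′ c → LeftPad p (v′ ++ [ c ]) →
  InitialHt (suc (suc k)) (integrate a (p ++ (v′ ++ [ c ]) ++ closing c)) →
  ∀ u → Ht (suc k) u → ¬ (u ≺ (v′ ++ [ c ]))
initial-derivative k a p v′ c lp (_ , ¬pred) u hu (_ , e) with ∷ʳ-injective v′ u e
... | refl , _ = ¬pred (integrate a (p ++ u ++ [ one ])) hu′ (lift-predecessor a p u c)
  where
  hu′ : Ht (suc (suc k)) (integrate a (p ++ u ++ [ one ]))
  hu′ = integrate-Ht (suc k) a _ (≢[]-++ʳ p (snoc≢[] u one)) (subst (Ht (suc k)) (sym (trim-predecessor u [ c ] lp)) hu)

initial-lifted : ∀ k s → InitialHt (suc (suc k)) s → ∃ λ v → InitialHt (suc k) v × s ∈ lifts v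
initial-lifted k s init with Ht-view (suc k) s (proj₁ init)
... | a , x , refl , _ , hv with trim-decompose x (proj₁ hv)
... | p , r , x≡ , lp , rp = trim x , padded (trim x) x≡ lp rp hv init
  where
  padded : ∀ v {x} → x ≡ p ++ v ++ r → LeftPad p v → RightPad r v → Ht (suc k) v →
    InitialHt (suc (suc k)) (integrate a x) → InitialHt (suc k) v × integrate a x ∈ lifts v
  padded v refl lp rp hv init with snocView v
  ... | inj₁ refl = ⊥-elim (proj₁ hv refl)
  ... | inj₂ (v′ , c , refl) with initial-closing k a p v′ c r lp rp hv init
  ...   | refl = (hv , initial-derivative k a p v′ c lp init) ,
                 subst (λ z → integrate a (p ++ (v′ ++ [ c ]) ++ closing z) ∈ lifts (v′ ++ [ c ]))
                   (lastOf-snoc one v′ c) (lift-∈ a (v′ ++ [ c ]) (leftPads-complete _ (snoc≢[] v′ c) lp))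

initials : ℕ → List Word
initials zero    = [ one ] ∷ [ two ] ∷ []
initials (suc k) = concatMap lifts (initials k)

letter-initial : ∀ a → InitialHt 1 [ a ]
letter-initial a = ((λ ()) , [] , D-letter a , refl) , no-predecessor
  where
  D-letter : ∀ a → D [ a ] ≡ just []
  D-letter one = refl
  D-letter two = refl
  no-predecessor : ∀ u → Ht 1 u → ¬ (u ≺ [ a ])
  no-predecessor u (u≢[] , _) (_ , e) = u≢[] (sym (proj₁ (∷ʳ-injective [] u e)))

-- An initial word of height 1 is the integral of 1 (not of 11, whose predecessor has height 1).
height-one-initial : ∀ s → InitialHt 1 s → s ∈ initials 0
height-one-initial s (hs , ¬pred) with Ht-view 0 s hs
... | a , x , refl , x≢[] , hx with trim-empty x x≢[] hx
...   | inj₂ refl = ⊥-elim (¬pred [ a ] (proj₁ (letter-initial a)) (other a , refl))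
...   | inj₁ refl with a
...     | one = here refl
...     | two = there (here refl)

initials-spec : ∀ k s → InitialHt (suc k) s ⇔ s ∈ initials k
initials-spec zero    s = mk⇔ (height-one-initial s) λ { (here refl) → letter-initial one ; (there (here refl)) → letter-initial two }
initials-spec (suc k) s = mk⇔ to from
  where
  to : InitialHt (suc (suc k)) s → s ∈ initials (suc k)
  to init = let v , init-v , s∈ = initial-lifted k s init in
    ∈-concatMap⁺ lifts (lose (Equivalence.to (initials-spec k v) init-v) s∈)
  from : s ∈ initials (suc k) → InitialHt (suc (suc k)) s
  from s∈ = let v , v∈ , s∈′ = find (∈-concatMap⁻ lifts s∈)
                b , p , p∈ , s≡ = ∈-lifts v s∈′ in
    subst (InitialHt (suc (suc k))) (sym s≡) (lift-initial k v b (Equivalence.from (initials-spec k v) v∈) p∈)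

-- No duplicates: a lift determines its derivative, so distinct words have
-- disjoint lifts; the lifts of one word differ in first letter or left pad.
lift-head : ∀ b v p → v ≢ [] → StartsWith b (lift b v p)
lift-head b v p v≢[] = integrate-head b (p ++ v ++ closingOf v) (≢[]-++ʳ p (≢[]-++ˡ (closingOf v) v≢[]))

∈-lifts-derivative : ∀ v {s} → s ∈ lifts v → D s ≡ just v
∈-lifts-derivative v s∈ with ∈-lifts v s∈
... | b , p , p∈ , refl = lift-derivative b v p∈

lifts-disjoint : ∀ {v v′} → v ≢ v′ → Disjoint (lifts v) (lifts v′)
lifts-disjoint v≢v′ (s∈ , s∈′) = v≢v′ (just-injective (trans (sym (∈-lifts-derivative _ s∈)) (∈-lifts-derivative _ s∈′)))

leftPads-unique : ∀ v → Unique (leftPads v)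
leftPads-unique []        = AllPairs.[]
leftPads-unique (one ∷ _) = [] AllPairs.∷ AllPairs.[]
leftPads-unique (two ∷ _) = ((λ ()) ∷ []) AllPairs.∷ ([] AllPairs.∷ AllPairs.[])

lifts-unique : ∀ v → Unique (lifts v)
lifts-unique []        = AllPairs.[]
lifts-unique v@(_ ∷ _) =
  Unique.++⁺ (Unique.map⁺ (lift-injective one) (leftPads-unique v))
             (Unique.map⁺ (lift-injective two) (leftPads-unique v)) different-heads
  where
  lift-injective : ∀ b {p p′} → lift b v p ≡ lift b v p′ → p ≡ p′
  lift-injective b {p} {p′} e = ++-cancelʳ (v ++ closingOf v) p p′ (integrate-injective b e)
  different-heads : Disjoint (map (lift one v) (leftPads v)) (map (lift two v) (leftPads v))
  different-heads (s∈₁ , s∈₂) with ∈-map⁻ (lift one v) s∈₁ | ∈-map⁻ (lift two v) s∈₂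
  ... | p , _ , refl | p′ , _ , e with lift-head one v p (λ ()) | lift-head two v p′ (λ ())
  ...   | _ , h₁ | _ , h₂ with trans (sym h₁) (trans e h₂)
  ...     | ()

initials-unique : ∀ k → Unique (initials k)
initials-unique zero    = ((λ ()) ∷ []) AllPairs.∷ ([] AllPairs.∷ AllPairs.[])
initials-unique (suc k) =
  Unique.concat⁺ (All.map⁺ (All.tabulate λ {v} _ → lifts-unique v))
                 (AllPairs.map⁺ (AllPairs.map lifts-disjoint (initials-unique k)))

-- The weight of v, its number of left pads, is 1 or 2 according to
-- its first letter.  Each word of weight w has 2w lifts, of total weight 3w
-- (w lifts starting with 1, w starting with 2); hence `initials k` has total
-- weight 3^(k+1) and 2·3^k elements.
weight : Word → ℕ
weight v = length (leftPads v)

lifts-length : ∀ v → length (lifts v) ≡ 2 * weight v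
lifts-length v = trans (length-++ (map (lift one v) (leftPads v)))
  (cong₂ _+_ (length-map (lift one v) (leftPads v)) (trans (length-map (lift two v) (leftPads v)) (sym (+-identityʳ _))))

lifts-weight : ∀ v → sum (map weight (lifts v)) ≡ 3 * weight v
lifts-weight []        = refl
lifts-weight v@(_ ∷ _) = begin
  sum (map weight (lifts v))                            ≡⟨ cong sum (map-++ weight (map (lift one v) ps) _) ⟩
  sum (map weight (map (lift one v) ps) ++ map weight (map (lift two v) ps))
                                                        ≡⟨ sum-++ (map weight (map (lift one v) ps)) _ ⟩
  sum (map weight (map (lift one v) ps)) + sum (map weight (map (lift two v) ps))
                                                        ≡⟨ cong₂ _+_ (uniform one ps) (uniform two ps) ⟩
  length ps * 1 + length ps * 2                         ≡⟨ sym (*-distribˡ-+ (length ps) 1 2) ⟩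
  length ps * 3                                         ≡⟨ *-comm (length ps) 3 ⟩
  3 * length ps                                         ∎
  where
  open ≡-Reasoning
  ps = leftPads v
  first-letter : ∀ b t → weight (b ∷ t) ≡ weight [ b ]
  first-letter one t = refl
  first-letter two t = refl
  uniform : ∀ b qs → sum (map weight (map (lift b v) qs)) ≡ length qs * weight [ b ]
  uniform b []       = refl
  uniform b (q ∷ qs) with lift-head b v q (λ ())
  ... | t , e = cong₂ _+_ (trans (cong weight e) (first-letter b t)) (uniform b qs)

lifted-measure : ∀ (g : List Word → ℕ) m → g [] ≡ 0 → (∀ xs ys → g (xs ++ ys) ≡ g xs + g ys) →
  (∀ v → g (lifts v) ≡ m * weight v) → ∀ L → g (concatMap lifts L) ≡ m * sum (map weight L)
lifted-measure g m g[] g-++ g-lifts []      = trans g[] (sym (*-zeroʳ m))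
lifted-measure g m g[] g-++ g-lifts (v ∷ L) = begin
  g (lifts v ++ concatMap lifts L)         ≡⟨ g-++ (lifts v) (concatMap lifts L) ⟩
  g (lifts v) + g (concatMap lifts L)      ≡⟨ cong₂ _+_ (g-lifts v) (lifted-measure g m g[] g-++ g-lifts L) ⟩
  m * weight v + m * sum (map weight L)    ≡⟨ sym (*-distribˡ-+ m (weight v) _) ⟩
  m * (weight v + sum (map weight L))      ∎
  where open ≡-Reasoning

initials-weight : ∀ k → sum (map weight (initials k)) ≡ 3 ^ suc k
initials-weight zero    = refl
initials-weight (suc k) =
  trans (lifted-measure (λ L → sum (map weight L)) 3 refl
          (λ xs ys → trans (cong sum (map-++ weight xs ys)) (sum-++ (map weight xs) _)) lifts-weight (initials k))
        (cong (3 *_) (initials-weight k))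

initials-length : ∀ k → length (initials k) ≡ 2 * 3 ^ k
initials-length zero    = refl
initials-length (suc k) =
  trans (lifted-measure length 2 refl (λ xs ys → length-++ xs) lifts-length (initials k))
        (cong (2 *_) (initials-weight k))

module SmoothChains (k : ℕ) = MaximalChains (P (suc k)) (P? (suc k))
  (λ w p p₁ p₂ → noBranch (suc k) w (P⇒Ht _ w p) (P⇒Ht _ _ p₁) (P⇒Ht _ _ p₂))
  (heightBound (suc k)) (λ w p → Ht-bounded (suc k) w (P⇒Ht _ w p))

smooth-initial⇔ : ∀ k s → SmoothChains.Initial k s ⇔ s ∈ initials k
smooth-initial⇔ k s = mk⇔
  (λ (p , ¬pred) → Equivalence.to (initials-spec k s) (P⇒Ht _ s p , λ v h r → ¬pred v (Ht⇒P _ v h) r))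
  (λ s∈ → let h , ¬pred = Equivalence.from (initials-spec k s) s∈ in
          Ht⇒P _ s h , λ v p r → ¬pred v (P⇒Ht _ v p) r)

theorem4 : (k : ℕ) →
    ((w : Word) → P (suc k) w →
      ∃ λ (c : List⁺ Word) → IsMRSE (suc k) c × w ∈ toList c ×
        ((c′ : List⁺ Word) → IsMRSE (suc k) c′ → w ∈ toList c′ → c′ ≡ c))
    ×
    (∃ λ (H : List (List⁺ Word)) → Unique H ×
      ((c : List⁺ Word) → IsMRSE (suc k) c ⇔ c ∈ H) ×
      length H ≡ 2 * 3 ^ k)
theorem4 k =
  let H , unique-H , chains⇔ , length-H = enumerate (initials k) (initials-unique k) (smooth-initial⇔ k)
  in partition , H , unique-H , chains⇔ , trans length-H (initials-length k)
  where open SmoothChains k using (partition; enumerate)
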